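{- Let $k$ be a positive integer, $D$ a $2k$-edge-connected digraph of order $n\geq 4k+2$ with underlying graph $G$, and let $(X_1,\dots,X_t,Y)$ be a $k$-certificate for $D$ with $|Y|\geq 2$. Then $Y=\{v\in V(G): d_G(v)\geq 2k+1\}$.
   Context: A digraph has no parallel arcs but may contain digons; its underlying graph $G$ is the multigraph obtained by forgetting orientations (a digon gives two parallel edges), and $D$ is $2k$-edge-connected if $G$ is. $d_G(S)$ is the number of edges of $G$ with exactly one endvertex in $S$; $d_G(v)$ is the degree of $v$; $d^+_D(S)$ is the number of arcs from $S$ to $V(D)\setminus S$. A $k$-certificate for $D$ is a partition $(X_1,\dots,X_t,Y)$ of $V(D)$ into non-empty parts such that, with $X=\bigcup_i X_i$: (i) $d_G(X_i)=2k$ for every $i$; (ii) for every $x\in X$, $y\in Y$ there is exactly one edge between $x$ and $y$ in $G$; (iii) $d^+_D(X)-\frac12|X|\cdot|Y|$ is an odd integer. -}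

module Defs where

open import Data.Nat using (ℕ; zero; suc; _+_; _*_; _≤_)
open import Data.Integer as ℤ using (ℤ; +_)
open import Data.Bool using (Bool; true; false; _∧_; not; if_then_else_)
open import Data.Fin using (Fin; zero; suc)
open import Data.Maybe using (Maybe; just; nothing; is-nothing; is-just)
open import Data.Product using (Σ; ∃; _×_; _,_)
open import Data.Fin as Fin using ()
open import Relation.Nullary.Decidable using (⌊_⌋)
open import Relation.Binary.PropositionalEquality using (_≡_; _≢_)

Σ[_] : (n : ℕ) → (Fin n → ℕ) → ℕ
Σ[ zero ] f = 0
Σ[ suc n ] f = f zero + Σ[ n ] (λ i → f (suc i))

b2n : Bool → ℕ
b2n true = 1
b2n false = 0

-- A digraph on vertex set Fin n: arc u v = true iff there is an arc u → v.
-- At most one arc u → v (no parallel arcs), no loops; digons allowed.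
record Digraph (n : ℕ) : Set where
  field
    arc   : Fin n → Fin n → Bool
    loopless : ∀ v → arc v v ≡ false
open Digraph public

VSet : ℕ → Set
VSet n = Fin n → Bool

card : ∀ {n} → VSet n → ℕ
card {n} S = Σ[ n ] (λ v → b2n (S v))

-- Number of edges between u and v in the underlying multigraph G
-- (a digon gives two parallel edges).
mult : ∀ {n} → Digraph n → Fin n → Fin n → ℕ
mult D u v = b2n (arc D u v) + b2n (arc D v u)

dG : ∀ {n} → Digraph n → VSet n → ℕ
dG {n} D S = Σ[ n ] (λ u → Σ[ n ] (λ v →
  if S u ∧ not (S v) then mult D u v else 0))

deg : ∀ {n} → Digraph n → Fin n → ℕ
deg {n} D v = Σ[ n ] (λ u → mult D v u)

dOut : ∀ {n} → Digraph n → VSet n → ℕ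
dOut {n} D S = Σ[ n ] (λ u → Σ[ n ] (λ v →
  if S u ∧ not (S v) then b2n (arc D u v) else 0))

EdgeConnected : ∀ {n} → ℕ → Digraph n → Set
EdgeConnected {n} m D =
  (S : VSet n) → (∃ λ u → S u ≡ true) → (∃ λ v → S v ≡ false) → m ≤ dG D S

-- A partition (X_1,...,X_t,Y) is encoded by a labelling
-- lab : Fin n → Maybe (Fin t), where lab v = just i means v ∈ X_{i+1}
-- and lab v = nothing means v ∈ Y.
partX : ∀ {n t} → (Fin n → Maybe (Fin t)) → Fin t → VSet n
partX lab i v with lab v
... | just j  = ⌊ j Fin.≟ i ⌋
... | nothing = false

setX : ∀ {n t} → (Fin n → Maybe (Fin t)) → VSet n
setX lab v = is-just (lab v)

setY : ∀ {n t} → (Fin n → Maybe (Fin t)) → VSet n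
setY lab v = is-nothing (lab v)

OddInt : ℤ → Set
OddInt x = ∃ λ (m : ℤ) → x ≡ (+ 2) ℤ.* m ℤ.+ (+ 1)

-- Condition (iii) "d⁺(X) − |X||Y|/2 is an odd integer" is stated equivalently
-- without division: 2·d⁺(X) − |X||Y| = 2·m for some odd integer m.
record IsCertificate {n : ℕ} (k : ℕ) (D : Digraph n) (t : ℕ)
                     (lab : Fin n → Maybe (Fin t)) : Set where
  field
    Xnonempty : ∀ i → ∃ λ v → lab v ≡ just i
    Ynonempty : ∃ λ v → lab v ≡ nothing
    cond-i    : ∀ i → dG D (partX lab i) ≡ 2 * k
    cond-ii   : ∀ x y → setX lab x ≡ true → setY lab y ≡ true → mult D x y ≡ 1
    cond-iii  : ∃ λ (m : ℤ) → OddInt m ×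
                  ((+ (2 * dOut D (setX lab))) ℤ.- (+ (card (setX lab) * card (setY lab)))
                     ≡ (+ 2) ℤ.* m)

-- Every x ∈ X is joined to every y ∈ Y, so the part X_i containing x has at least |Y|
-- cut edges at x; X is non-empty by the parity condition (iii), hence |Y| ≤ d_G(X_i) = 2k,
-- and every y ∈ Y has degree at least |X| = n − |Y| ≥ 2k + 2. Conversely, let v ∈ X_i.
-- Each u ∈ X_i shares at most 2 ≤ |Y| edges with v but has at least |Y| cut edges, and
-- u = v shares none; so d_G(v) = Σ_{u ∈ X_i} mult(v,u) + (cut edges at v) ≤ d_G(X_i) = 2k.
module Submission where

open import Defs
open import Data.Nat using (ℕ; zero; suc; _+_; _*_; _≤_; z≤n)
open import Data.Nat.Properties
  using (≤-refl; ≤-trans; ≤-reflexive; +-mono-≤; +-assoc; +-comm; +-identityʳ;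
         m≤m+n; m≤n+m; +-cancelʳ-≤; m+1+n≰m; +-commutativeSemigroup; module ≤-Reasoning)
open import Data.Nat.Tactic.RingSolver using (solve-∀)
open import Algebra.Properties.CommutativeSemigroup +-commutativeSemigroup using (interchange; x∙yz≈y∙xz)
open import Data.Integer as ℤ using ()
open import Data.Fin using (Fin; zero; suc)
open import Data.Fin.Properties using (any?)
open import Data.Maybe using (Maybe; just; nothing)
open import Data.Bool using (true; false; _∧_; not; if_then_else_)
open import Data.Bool.Properties using (¬-not; T-≡) renaming (_≟_ to _≟ᵇ_)
open import Data.Product using (∃; _×_; _,_)
open import Data.Empty using (⊥-elim)
open import Function.Bundles using (Equivalence)
open import Relation.Nullary using (yes; no)
open import Relation.Nullary.Decidable using (fromWitness)
open import Relation.Binary.PropositionalEquality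
  using (_≡_; _≢_; refl; sym; trans; cong; cong₂; module ≡-Reasoning)

Σ-cong : ∀ n {f g : Fin n → ℕ} → (∀ i → f i ≡ g i) → Σ[ n ] f ≡ Σ[ n ] g
Σ-cong zero    f≗g = refl
Σ-cong (suc n) f≗g = cong₂ _+_ (f≗g zero) (Σ-cong n (λ i → f≗g (suc i)))

Σ-mono-≤ : ∀ n {f g : Fin n → ℕ} → (∀ i → f i ≤ g i) → Σ[ n ] f ≤ Σ[ n ] g
Σ-mono-≤ zero    f≤g = z≤n
Σ-mono-≤ (suc n) f≤g = +-mono-≤ (f≤g zero) (Σ-mono-≤ n (λ i → f≤g (suc i)))

Σ-distrib-+ : ∀ n (f g : Fin n → ℕ) → Σ[ n ] (λ i → f i + g i) ≡ Σ[ n ] f + Σ[ n ] g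
Σ-distrib-+ zero    f g = refl
Σ-distrib-+ (suc n) f g = begin
  f zero + g zero + Σ[ n ] (λ i → f (suc i) + g (suc i))
    ≡⟨ cong (f zero + g zero +_) (Σ-distrib-+ n (λ i → f (suc i)) (λ i → g (suc i))) ⟩
  f zero + g zero + (Σ[ n ] (λ i → f (suc i)) + Σ[ n ] (λ i → g (suc i)))
    ≡⟨ interchange (f zero) (g zero) _ _ ⟩
  Σ[ suc n ] f + Σ[ suc n ] g ∎
  where open ≡-Reasoning

Σ-zero : ∀ n {f : Fin n → ℕ} → (∀ i → f i ≡ 0) → Σ[ n ] f ≡ 0
Σ-zero zero    f≗0 = refl
Σ-zero (suc n) f≗0 = cong₂ _+_ (f≗0 zero) (Σ-zero n (λ i → f≗0 (suc i)))

Σ-1 : ∀ n → Σ[ n ] (λ _ → 1) ≡ n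
Σ-1 zero    = refl
Σ-1 (suc n) = cong suc (Σ-1 n)

term≤Σ : ∀ n (f : Fin n → ℕ) i → f i ≤ Σ[ n ] f
term≤Σ (suc n) f zero    = m≤m+n (f zero) _
term≤Σ (suc n) f (suc i) = ≤-trans (term≤Σ n (λ j → f (suc j)) i) (m≤n+m _ (f zero))

Σ-mono-≤-surplus : ∀ n (f g : Fin n → ℕ) (v : Fin n) (c : ℕ) →
  (∀ u → u ≢ v → f u ≤ g u) → c + f v ≤ g v → c + Σ[ n ] f ≤ Σ[ n ] g
Σ-mono-≤-surplus (suc n) f g zero c f≤g c+fv≤gv = begin
  c + (f zero + Σ[ n ] (λ u → f (suc u)))  ≡⟨ sym (+-assoc c _ _) ⟩
  c + f zero + Σ[ n ] (λ u → f (suc u))    ≤⟨ +-mono-≤ c+fv≤gv (Σ-mono-≤ n (λ u → f≤g (suc u) λ ())) ⟩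
  Σ[ suc n ] g                             ∎
  where open ≤-Reasoning
Σ-mono-≤-surplus (suc n) f g (suc v) c f≤g c+fv≤gv = begin
  c + (f zero + Σ[ n ] (λ u → f (suc u)))  ≡⟨ x∙yz≈y∙xz c (f zero) _ ⟩
  f zero + (c + Σ[ n ] (λ u → f (suc u)))  ≤⟨ +-mono-≤ (f≤g zero λ ())
                                               (Σ-mono-≤-surplus n (λ u → f (suc u)) (λ u → g (suc u)) v c
                                                 (λ u u≢v → f≤g (suc u) λ { refl → u≢v refl }) c+fv≤gv) ⟩
  Σ[ suc n ] g                             ∎
  where open ≤-Reasoning

if-then-0-≤ : ∀ b {x y} → (b ≡ true → x ≤ y) → (if b then x else 0) ≤ y
if-then-0-≤ true  x≤y = x≤y refl
if-then-0-≤ false _   = z≤n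

-- dG D S is definitionally the sum of cutDegree D S over all vertices.
cutDegree : ∀ {n} → Digraph n → VSet n → Fin n → ℕ
cutDegree {n} D S u = Σ[ n ] (λ w → if S u ∧ not (S w) then mult D u w else 0)

degreeInto : ∀ {n} → Digraph n → VSet n → Fin n → ℕ
degreeInto {n} D S v = Σ[ n ] (λ u → if S u then mult D v u else 0)

module _ {n : ℕ} (D : Digraph n) where

  mult≤2 : ∀ u v → mult D u v ≤ 2
  mult≤2 u v = +-mono-≤ (b2n≤1 (arc D u v)) (b2n≤1 (arc D v u))
    where
    b2n≤1 : ∀ b → b2n b ≤ 1
    b2n≤1 true  = ≤-refl
    b2n≤1 false = z≤n

  mult-sym : ∀ u v → mult D u v ≡ mult D v u
  mult-sym u v = +-comm (b2n (arc D u v)) (b2n (arc D v u))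

  mult-self : ∀ u → mult D u u ≡ 0
  mult-self u rewrite loopless D u = refl

  cutDegree≤dG : ∀ S u → cutDegree D S u ≤ dG D S
  cutDegree≤dG S = term≤Σ n (cutDegree D S)

  deg-split : ∀ S {v} → S v ≡ true → deg D v ≡ degreeInto D S v + cutDegree D S v
  deg-split S {v} v∈S = trans (Σ-cong n split) (Σ-distrib-+ n _ _)
    where
    split : ∀ u → mult D v u ≡ (if S u then mult D v u else 0)
                                + (if S v ∧ not (S u) then mult D v u else 0)
    split u rewrite v∈S with S u
    ... | true  = sym (+-identityʳ _)
    ... | false = refl

module _ {n t : ℕ} (lab : Fin n → Maybe (Fin t)) where

  partX-self : ∀ {i v} → lab v ≡ just i → partX lab i v ≡ true
  partX-self {i} {v} lab-v rewrite lab-v = Equivalence.to T-≡ (fromWitness refl)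

  partX⇒setX : ∀ i {v} → partX lab i v ≡ true → setX lab v ≡ true
  partX⇒setX i {v} v∈Xᵢ with lab v
  ... | just _ = refl
  partX⇒setX i () | nothing

  setY⇒∉partX : ∀ i {v} → setY lab v ≡ true → partX lab i v ≡ false
  setY⇒∉partX i {v} v∈Y with lab v
  ... | nothing = refl
  setY⇒∉partX i () | just _

  setX⇒just : ∀ {v} → setX lab v ≡ true → ∃ λ i → lab v ≡ just i
  setX⇒just {v} v∈X with lab v
  ... | just i = i , refl
  setX⇒just () | nothing

  card-setX+card-setY : card (setX lab) + card (setY lab) ≡ n
  card-setX+card-setY = begin
    card (setX lab) + card (setY lab)                          ≡⟨ Σ-distrib-+ n _ _ ⟨
    Σ[ n ] (λ v → b2n (setX lab v) + b2n (setY lab v))        ≡⟨ Σ-cong n X+Y≡1 ⟩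
    Σ[ n ] (λ _ → 1)                                           ≡⟨ Σ-1 n ⟩
    n                                                          ∎
    where
    open ≡-Reasoning
    X+Y≡1 : ∀ v → b2n (setX lab v) + b2n (setY lab v) ≡ 1
    X+Y≡1 v with lab v
    ... | just _  = refl
    ... | nothing = refl

2*odd≢0 : ∀ {m} → OddInt m → ℤ.+ 2 ℤ.* m ≢ ℤ.+ 0
2*odd≢0 (ℤ.+ zero         , refl) ()
2*odd≢0 (ℤ.+ suc _        , refl) ()
2*odd≢0 (ℤ.-[1+ zero ]    , refl) ()
2*odd≢0 (ℤ.-[1+ suc _ ]   , refl) ()

module Certificate {k n t : ℕ} {D : Digraph n} {lab : Fin n → Maybe (Fin t)}
                   (cert : IsCertificate k D t lab) where
  open IsCertificate cert

  X-nonempty : ∃ λ x → setX lab x ≡ true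
  X-nonempty with any? (λ x → setX lab x ≟ᵇ true) | cond-iii
  ... | yes x∈X | _ = x∈X
  ... | no  X≡∅ | _ , m-odd , 2dOut−|X||Y|≡2m =
    ⊥-elim (2*odd≢0 m-odd (trans (sym 2dOut−|X||Y|≡2m) 2dOut−|X||Y|≡0))
    where
    ∉X : ∀ v → setX lab v ≡ false
    ∉X v = ¬-not λ v∈X → X≡∅ (v , v∈X)
    |X|≡0 : card (setX lab) ≡ 0
    |X|≡0 = Σ-zero n (λ v → cong b2n (∉X v))
    dOut≡0 : dOut D (setX lab) ≡ 0
    dOut≡0 = Σ-zero n λ u → Σ-zero n λ w → cong (λ b → if b ∧ not (setX lab w) then b2n (arc D u w) else 0) (∉X u)
    2dOut−|X||Y|≡0 : ℤ.+ (2 * dOut D (setX lab)) ℤ.- ℤ.+ (card (setX lab) * card (setY lab)) ≡ ℤ.+ 0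
    2dOut−|X||Y|≡0 = cong₂ (λ d x → ℤ.+ (2 * d) ℤ.- ℤ.+ (x * card (setY lab))) dOut≡0 |X|≡0

  |Y|≤cutDegree : ∀ i {u} → partX lab i u ≡ true → card (setY lab) ≤ cutDegree D (partX lab i) u
  |Y|≤cutDegree i {u} u∈Xᵢ rewrite u∈Xᵢ = Σ-mono-≤ n edge-to-Y
    where
    edge-to-Y : ∀ w → b2n (setY lab w) ≤ (if not (partX lab i w) then mult D u w else 0)
    edge-to-Y w with setY lab w in w∈Y
    ... | false = z≤n
    ... | true rewrite setY⇒∉partX lab i w∈Y | cond-ii u w (partX⇒setX lab i u∈Xᵢ) w∈Y = ≤-refl

  |Y|≤2k : card (setY lab) ≤ 2 * k
  |Y|≤2k with X-nonempty
  ... | x , x∈X with setX⇒just lab x∈X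
  ... | i , lab-x = begin
    card (setY lab)                  ≤⟨ |Y|≤cutDegree i (partX-self lab lab-x) ⟩
    cutDegree D (partX lab i) x      ≤⟨ cutDegree≤dG D (partX lab i) x ⟩
    dG D (partX lab i)               ≡⟨ cond-i i ⟩
    2 * k                            ∎
    where open ≤-Reasoning

  |X|≤deg : ∀ {y} → setY lab y ≡ true → card (setX lab) ≤ deg D y
  |X|≤deg {y} y∈Y = Σ-mono-≤ n edge-from-X
    where
    edge-from-X : ∀ u → b2n (setX lab u) ≤ mult D y u
    edge-from-X u with setX lab u in u∈X
    ... | false = z≤n
    ... | true  = ≤-reflexive (sym (trans (mult-sym D y u) (cond-ii u y u∈X y∈Y)))

  deg-Y : 4 * k + 2 ≤ n → ∀ {y} → setY lab y ≡ true → 2 * k + 1 ≤ deg D y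
  deg-Y n≥4k+2 {y} y∈Y = +-cancelʳ-≤ (2 * k) (2 * k + 1) (deg D y) (begin
    2 * k + 1 + 2 * k                ≤⟨ m≤m+n _ 1 ⟩
    2 * k + 1 + 2 * k + 1            ≡⟨ arith k ⟩
    4 * k + 2                        ≤⟨ n≥4k+2 ⟩
    n                                ≡⟨ card-setX+card-setY lab ⟨
    card (setX lab) + card (setY lab) ≤⟨ +-mono-≤ (|X|≤deg y∈Y) |Y|≤2k ⟩
    deg D y + 2 * k                  ∎)
    where
    open ≤-Reasoning
    arith : ∀ k → 2 * k + 1 + 2 * k + 1 ≡ 4 * k + 2
    arith = solve-∀

  deg-X : 2 ≤ card (setY lab) → ∀ {v} i → lab v ≡ just i → deg D v ≤ 2 * k
  deg-X |Y|≥2 {v} i lab-v = begin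
    deg D v                                   ≡⟨ deg-split D Xᵢ v∈Xᵢ ⟩
    degreeInto D Xᵢ v + cutDegree D Xᵢ v      ≡⟨ +-comm _ (cutDegree D Xᵢ v) ⟩
    cutDegree D Xᵢ v + degreeInto D Xᵢ v      ≤⟨ Σ-mono-≤-surplus n _ _ v _ (λ u _ → edges-to≤cutDegree u) at-v ⟩
    dG D Xᵢ                                   ≡⟨ cond-i i ⟩
    2 * k                                     ∎
    where
    open ≤-Reasoning
    Xᵢ = partX lab i
    v∈Xᵢ = partX-self lab lab-v
    edges-to≤cutDegree : ∀ u → (if Xᵢ u then mult D v u else 0) ≤ cutDegree D Xᵢ u
    edges-to≤cutDegree u = if-then-0-≤ (Xᵢ u) λ u∈Xᵢ →
      ≤-trans (mult≤2 D v u) (≤-trans |Y|≥2 (|Y|≤cutDegree i u∈Xᵢ))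
    at-v : cutDegree D Xᵢ v + (if Xᵢ v then mult D v v else 0) ≤ cutDegree D Xᵢ v
    at-v rewrite v∈Xᵢ | mult-self D v = ≤-reflexive (+-identityʳ _)

mainTheorem16 : (k n : ℕ) → 1 ≤ k → 4 * k + 2 ≤ n →
    (D : Digraph n) → EdgeConnected (2 * k) D →
    (t : ℕ) → (lab : Fin n → Maybe (Fin t)) → IsCertificate k D t lab →
    2 ≤ card (setY lab) →
    (v : Fin n) → ((setY lab v ≡ true → 2 * k + 1 ≤ deg D v) × (2 * k + 1 ≤ deg D v → setY lab v ≡ true))
mainTheorem16 k n _ n≥4k+2 D _ _ lab cert |Y|≥2 v = deg-Y n≥4k+2 , deg⇒Y
  where
  open Certificate cert
  deg⇒Y : 2 * k + 1 ≤ deg D v → setY lab v ≡ true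
  deg⇒Y deg≥2k+1 with lab v in lab-v
  ... | nothing = refl
  ... | just i  = ⊥-elim (m+1+n≰m (2 * k) (≤-trans deg≥2k+1 (deg-X |Y|≥2 i lab-v)))
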